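{- Let $M$ be a binary matrix that does not have the consecutive-ones property, in which every Tucker submatrix contains all rows of $M$, and such that, excluding the last row $Z$ of $M$, the overlap graph of the rows of $M$ is a path $\mathcal{P}'=(R_1,R_2,\dots,R_h)$ (so $R_i$ overlaps $R_j$ iff $|i-j|=1$). For $i\in\{1,\dots,h-1\}$ let $\mathcal{A}_i=\{R_i\setminus R_{i+1},\ R_i\cap R_{i+1},\ R_{i+1}\setminus R_i\}$ and $\mathcal{A}=\bigcup_{i=1}^{h-1}\mathcal{A}_i$. Let $C_Q=\bigcup_{i=1}^h R_i$ and let $C\subseteq C_Q$. Then the overlap graph of $\mathcal{P}'[C]=(R_1\cap C,\dots,R_h\cap C)$ is connected if and only if every element of $\mathcal{A}$ contains an element of $C$.
   Context: Rows are identified with the sets of columns in which they have a 1. A set of rows has the consecutive-ones property if the columns can be ordered so that the 1's in each row are consecutive. A Tucker matrix is a binary matrix without the consecutive-ones property such that deleting any single row or column yields a matrix with that property; a Tucker submatrix is a submatrix that is a Tucker matrix. Two rows (sets) overlap if they intersect and neither contains the other; the overlap graph of a family of rows has the rows as vertices, with edges between overlapping rows. -}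

module Defs where

open import Data.Nat using (ℕ; suc)
open import Data.Fin using (Fin; toℕ; inject₁; fromℕ; _<_)
open import Data.Fin.Subset using (Subset; ⊤; _∈_; _∉_; _⊆_; _∩_; _-_; Nonempty)
open import Data.Fin.Permutation using (Permutation′; _⟨$⟩ʳ_)
open import Data.Product using (_×_; Σ; _,_)
open import Relation.Nullary using (¬_)
open import Relation.Binary.Construct.Closure.ReflexiveTransitive using (Star)

-- A binary matrix with m rows and n columns; each row is identified
-- with the set of columns in which it has a 1.
Matrix : ℕ → ℕ → Set
Matrix m n = Fin m → Subset n

-- Consecutive-ones property of the submatrix of M with row set T and
-- column set S: there is an ordering of the columns (a permutation π of
-- all columns; its restriction to S is an arbitrary ordering of S) such
-- that for every selected row r, the 1's of r within S are consecutive
-- among the columns of S.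
C1P : ∀ {m n} → Matrix m n → Subset m → Subset n → Set
C1P {m} {n} M T S =
  Σ (Permutation′ n) λ π →
    ∀ (r : Fin m) → r ∈ T →
    ∀ (a b c : Fin n) → a ∈ S → b ∈ S → c ∈ S →
      (π ⟨$⟩ʳ a) < (π ⟨$⟩ʳ b) → (π ⟨$⟩ʳ b) < (π ⟨$⟩ʳ c) →
      a ∈ M r → c ∈ M r → b ∈ M r

Tucker : ∀ {m n} → Matrix m n → Subset m → Subset n → Set
Tucker {m} {n} M T S =
  ¬ C1P M T S
  × (∀ (r : Fin m) → r ∈ T → C1P M (T - r) S)
  × (∀ (c : Fin n) → c ∈ S → C1P M T (S - c))

HasC1P : ∀ {m n} → Matrix m n → Set
HasC1P M = C1P M ⊤ ⊤

Overlap : ∀ {n} → Subset n → Subset n → Set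
Overlap A B = Nonempty (A ∩ B) × ¬ (A ⊆ B) × ¬ (B ⊆ A)

OverlapConnected : ∀ {h n} → (Fin h → Subset n) → Set
OverlapConnected {h} F = ∀ (i j : Fin h) → Star (λ a b → Overlap (F a) (F b)) i j

-- Shrinking every set to its trace on C can only destroy overlaps, so the
-- overlap graph of P'[C] is a spanning subgraph of the path P'. Such a graph
-- is connected exactly when it keeps every edge R_i R_{i+1} of the path,
-- because a walk from R_i to R_{i+1} must cross from indices ≤ i to
-- indices > i along an edge joining consecutive indices. Finally
-- R_i ∩ C and R_{i+1} ∩ C overlap iff C meets each of R_i ∖ R_{i+1},
-- R_i ∩ R_{i+1} and R_{i+1} ∖ R_i.
module Submission where

open import Defs
open import Data.Nat using (ℕ; suc)
open import Data.Fin using (Fin; inject₁; fromℕ; toℕ)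
open import Data.Fin.Subset using (Subset; ⊤; _∈_; _⊆_; _∩_; _─_; Nonempty; ⋃)
open import Data.List using (map; allFin)
open import Data.Product using (_×_)
open import Data.Sum using (_⊎_)
open import Relation.Nullary using (¬_)
open import Relation.Binary.PropositionalEquality using (_≡_)
open import Function.Bundles using (_⇔_)

open import Algebra.Properties.IdempotentCommutativeMonoid using (∙-distrʳ-∙)
open import Data.Empty using (⊥-elim)
open import Data.Fin using (fromℕ<)
open import Data.Fin.Properties using (toℕ-injective; toℕ-fromℕ<; toℕ<n)
open import Data.Fin.Subset using (_∉_; inside; outside)
open import Data.Fin.Subset.Properties
  using (_∈?_; nonempty?; p∩q⊆p; p─q⊆p; x∈p∧x∉q⇒x∈p─q; x∈p∩q⁺; x∈p∩q⁻; ∩-idempotentCommutativeMonoid)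
open import Data.Nat using (zero; _+_; _∸_; _≤_; _<_; _≤?_; s≤s⁻¹)
open import Data.Nat.Properties
  using (≤-refl; ≤-reflexive; ≤-trans; ≤-antisym; ≤-total; <-irrefl; ≤-<-trans; ≰⇒>; n≤1+n; m≤n+m; m∸n+n≡m; +-suc)
open import Data.Product using (_,_; swap)
open import Data.Sum using (inj₁; inj₂; [_,_]′)
open import Data.Vec using (_∷_; []; here; there)
open import Function using (_∘_)
open import Function.Bundles using (mk⇔; Equivalence)
open import Function.Construct.Composition using (_⇔-∘_)
open import Level using (0ℓ)
open import Relation.Binary using (Rel; Symmetric)
open import Relation.Binary.Construct.Closure.ReflexiveTransitive using (Star; ε; _◅_; reverse)
open import Relation.Binary.PropositionalEquality using (refl; sym; trans; cong; subst; subst₂; module ≡-Reasoning)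
open import Relation.Nullary using (yes; no; contradiction)

private
  variable
    n : ℕ
    x : Fin n
    p q : Subset n

x∈p─q⇒x∉q : ∀ (p q : Subset n) → x ∈ p ─ q → x ∉ q
x∈p─q⇒x∉q (inside ∷ p) (outside ∷ q) here ()
x∈p─q⇒x∉q (_ ∷ p) (outside ∷ q) (there x∈p─q) (there x∈q) = x∈p─q⇒x∉q p q x∈p─q x∈q
x∈p─q⇒x∉q (_ ∷ p) (inside ∷ q) (there x∈p─q) (there x∈q) = x∈p─q⇒x∉q p q x∈p─q x∈q

nonempty-mono : p ⊆ q → Nonempty p → Nonempty q
nonempty-mono p⊆q (x , x∈p) = x , p⊆q x∈p

nonempty-─⇔⊈ : ∀ (p q : Subset n) → Nonempty (p ─ q) ⇔ (¬ p ⊆ q)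
nonempty-─⇔⊈ p q = mk⇔ nonempty⇒⊈ ⊈⇒nonempty
  where
  nonempty⇒⊈ : Nonempty (p ─ q) → ¬ p ⊆ q
  nonempty⇒⊈ (x , x∈p─q) p⊆q = x∈p─q⇒x∉q p q x∈p─q (p⊆q (p─q⊆p p q x∈p─q))

  ⊈⇒nonempty : ¬ p ⊆ q → Nonempty (p ─ q)
  ⊈⇒nonempty p⊈q with nonempty? (p ─ q)
  ... | yes ne = ne
  ... | no empty = ⊥-elim (p⊈q p⊆q)
    where
    p⊆q : p ⊆ q
    p⊆q {x} x∈p with x ∈? q
    ... | yes x∈q = x∈q
    ... | no x∉q = ⊥-elim (empty (x , x∈p∧x∉q⇒x∈p─q x∈p x∉q))

─-∩-distribʳ : ∀ (p q r : Subset n) → (p ─ q) ∩ r ≡ (p ∩ r) ─ (q ∩ r)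
─-∩-distribʳ [] [] [] = refl
─-∩-distribʳ (_ ∷ p) (inside ∷ q) (inside ∷ r) = cong (_ ∷_) (─-∩-distribʳ p q r)
─-∩-distribʳ (_ ∷ p) (outside ∷ q) (inside ∷ r) = cong (_ ∷_) (─-∩-distribʳ p q r)
─-∩-distribʳ (inside ∷ p) (inside ∷ q) (outside ∷ r) = cong (_ ∷_) (─-∩-distribʳ p q r)
─-∩-distribʳ (inside ∷ p) (outside ∷ q) (outside ∷ r) = cong (_ ∷_) (─-∩-distribʳ p q r)
─-∩-distribʳ (outside ∷ p) (inside ∷ q) (outside ∷ r) = cong (_ ∷_) (─-∩-distribʳ p q r)
─-∩-distribʳ (outside ∷ p) (outside ∷ q) (outside ∷ r) = cong (_ ∷_) (─-∩-distribʳ p q r)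

∩-∩-distribʳ : ∀ (p q r : Subset n) → (p ∩ q) ∩ r ≡ (p ∩ r) ∩ (q ∩ r)
∩-∩-distribʳ {n} p q r = ∙-distrʳ-∙ (∩-idempotentCommutativeMonoid n) r p q

open Equivalence using (to; from)

overlap-sym : Symmetric (Overlap {n})
overlap-sym {x = p} {q} ((x , x∈p∩q) , p⊈q , q⊈p) =
  (x , x∈p∩q⁺ (swap (x∈p∩q⁻ p q x∈p∩q))) , q⊈p , p⊈q

overlap⇔nonempty-parts : ∀ (p q : Subset n) →
  Overlap p q ⇔ (Nonempty (p ─ q) × Nonempty (p ∩ q) × Nonempty (q ─ p))
overlap⇔nonempty-parts p q = mk⇔
  (λ (meet , p⊈q , q⊈p) → from (nonempty-─⇔⊈ p q) p⊈q , meet , from (nonempty-─⇔⊈ q p) q⊈p)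
  (λ (p─q , meet , q─p) → meet , to (nonempty-─⇔⊈ p q) p─q , to (nonempty-─⇔⊈ q p) q─p)

overlap-∩⇔ : ∀ (p q r : Subset n) →
  Overlap (p ∩ r) (q ∩ r) ⇔ (Nonempty ((p ─ q) ∩ r) × Nonempty ((p ∩ q) ∩ r) × Nonempty ((q ─ p) ∩ r))
overlap-∩⇔ p q r
  rewrite ─-∩-distribʳ p q r | ─-∩-distribʳ q p r | ∩-∩-distribʳ p q r
  = overlap⇔nonempty-parts (p ∩ r) (q ∩ r)

overlap-∩⁻ : ∀ (p q r : Subset n) → Overlap (p ∩ r) (q ∩ r) → Overlap p q
overlap-∩⁻ p q r overlap-∩ with to (overlap-∩⇔ p q r) overlap-∩
... | p─q , meet , q─p = from (overlap⇔nonempty-parts p q)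
  ( nonempty-mono (p∩q⊆p (p ─ q) r) p─q
  , nonempty-mono (p∩q⊆p (p ∩ q) r) meet
  , nonempty-mono (p∩q⊆p (q ─ p) r) q─p )

Consecutive : ∀ {h} → Rel (Fin h) 0ℓ
Consecutive i j = suc (toℕ i) ≡ toℕ j

module _ {h ℓ} (E : Rel (Fin h) ℓ) where

  SubgraphOfPath : Set ℓ
  SubgraphOfPath = ∀ {i j} → E i j → Consecutive i j ⊎ Consecutive j i

  ContainsPath : Set ℓ
  ContainsPath = ∀ i j → Consecutive i j → E i j

  walk-crosses : SubgraphOfPath → ∀ {i j a b} → Consecutive i j → Star E a b →
    toℕ a ≤ toℕ i → toℕ j ≤ toℕ b → E i j
  walk-crosses _ i→j ε a≤i j≤b = ⊥-elim (<-irrefl refl (≤-trans (≤-reflexive i→j) (≤-trans j≤b a≤i)))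
  walk-crosses sub {i} {j} {a} i→j (_◅_ {j = a′} e rest) a≤i j≤b with toℕ a′ ≤? toℕ i
  ... | yes a′≤i = walk-crosses sub i→j rest a′≤i j≤b
  ... | no a′≰i with sub e
  ...   | inj₂ a′→a = contradiction (≤-trans (n≤1+n _) (≤-trans (≤-reflexive a′→a) a≤i)) a′≰i
  ...   | inj₁ a→a′ = subst₂ E a≡i a′≡j e
    where
    a≡i : a ≡ i
    a≡i = toℕ-injective (≤-antisym a≤i (s≤s⁻¹ (≤-trans (≰⇒> a′≰i) (≤-reflexive (sym a→a′)))))
    a′≡j : a′ ≡ j
    a′≡j = toℕ-injective (trans (sym a→a′) (trans (cong (suc ∘ toℕ) a≡i) i→j))

  ascending-walk : ContainsPath → ∀ {i j} → toℕ i ≤ toℕ j → Star E i j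
  ascending-walk edges {i} {j} i≤j = go (toℕ j ∸ toℕ i) i (sym (m∸n+n≡m i≤j))
    where
    go : ∀ k a → toℕ j ≡ k + toℕ a → Star E a j
    go zero a j≡a = subst (Star E a) (toℕ-injective (sym j≡a)) ε
    go (suc k) a j≡k+1+a = edges a next (sym toℕ-next) ◅ go k next j≡k+next
      where
      next<h : suc (toℕ a) < h
      next<h = ≤-<-trans (≤-trans (m≤n+m _ k) (≤-reflexive (trans (+-suc k _) (sym j≡k+1+a)))) (toℕ<n j)
      next : Fin h
      next = fromℕ< next<h
      toℕ-next : toℕ next ≡ suc (toℕ a)
      toℕ-next = toℕ-fromℕ< next<h
      j≡k+next : toℕ j ≡ k + toℕ next
      j≡k+next = begin
        toℕ j                ≡⟨ j≡k+1+a ⟩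
        suc k + toℕ a        ≡⟨ +-suc k (toℕ a) ⟨
        k + suc (toℕ a)      ≡⟨ cong (k +_) toℕ-next ⟨
        k + toℕ next         ∎
        where open ≡-Reasoning

  connected⇔containsPath : Symmetric E → SubgraphOfPath →
    (∀ i j → Star E i j) ⇔ ContainsPath
  connected⇔containsPath E-sym sub = mk⇔
    (λ connected i j i→j → walk-crosses sub i→j (connected i j) ≤-refl ≤-refl)
    (λ edges i j → [ ascending-walk edges , reverse E-sym ∘ ascending-walk edges ]′ (≤-total (toℕ i) (toℕ j)))

-- Only the direction "overlap ⇒ consecutive" of the path hypothesis is used.
lemma17 : ∀ {h n} (M : Matrix (suc h) n) →
    ¬ HasC1P M →
    (∀ (T : Subset (suc h)) (S : Subset n) → Tucker M T S → ∀ r → r ∈ T) →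
    (∀ (i j : Fin h) →
      Overlap (M (inject₁ i)) (M (inject₁ j)) ⇔ ((suc (toℕ i) ≡ toℕ j) ⊎ (suc (toℕ j) ≡ toℕ i))) →
    (C : Subset n) →
    C ⊆ ⋃ (map (λ i → M (inject₁ i)) (allFin h)) →
    OverlapConnected (λ (i : Fin h) → M (inject₁ i) ∩ C)
      ⇔ (∀ (i j : Fin h) → suc (toℕ i) ≡ toℕ j →
           Nonempty ((M (inject₁ i) ─ M (inject₁ j)) ∩ C)
           × Nonempty ((M (inject₁ i) ∩ M (inject₁ j)) ∩ C)
           × Nonempty ((M (inject₁ j) ─ M (inject₁ i)) ∩ C))
lemma17 M _ _ overlap⇔consecutive C _ = edges⇔parts ⇔-∘ connected⇔containsPath E overlap-sym subgraph
  where
  R : Fin _ → Subset _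
  R i = M (inject₁ i)

  E : Rel (Fin _) 0ℓ
  E i j = Overlap (R i ∩ C) (R j ∩ C)

  subgraph : SubgraphOfPath E
  subgraph {i} {j} e = to (overlap⇔consecutive i j) (overlap-∩⁻ (R i) (R j) C e)

  edges⇔parts : ContainsPath E ⇔ (∀ i j → Consecutive i j →
    Nonempty ((R i ─ R j) ∩ C) × Nonempty ((R i ∩ R j) ∩ C) × Nonempty ((R j ─ R i) ∩ C))
  edges⇔parts = mk⇔
    (λ edges i j i→j → to (overlap-∩⇔ (R i) (R j) C) (edges i j i→j))
    (λ parts i j i→j → from (overlap-∩⇔ (R i) (R j) C) (parts i j i→j))
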